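{- Let $n\ge 3$, $\alpha,\mathbf e\in\{0,1\}$, and $A\in\mathcal{PSC}_n^{\alpha,\mathbf e}$. Then $\exp(A)$ is even.
   Context: For $n\ge 3$, let $C_n$ be the set of $n\times n$ real matrices $A$ whose row $i$ ($1\le i\le n-1$) has a single entry $1$ in column $i+1$ and zeros elsewhere, and whose last row $(a_{n,1},\dots,a_{n,n})$ has all entries in $\{0,1\}$. For $A\in C_n$ put $F(A)=A+A^T$. For $\alpha,\mathbf e\in\{0,1\}$ let $C_n^{\alpha,\mathbf e}=\{F(A): A\in C_n,\ a_{n,1}=\alpha,\ a_{n,n}=\mathbf e\}$ and $\mathcal{PSC}_n^{\alpha,\mathbf e}$ the set of primitive matrices in $C_n^{\alpha,\mathbf e}$. A nonnegative square matrix $B$ is primitive if $B^k>0$ entrywise for some positive integer $k$, and its exponent $\exp(B)$ is the least such $k$. -}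

module Defs where

open import Data.Nat using (ℕ; zero; suc; _+_; _*_; _≤_; _<_)
open import Data.Nat.Properties using (_≟_)
open import Data.Fin using (Fin; toℕ; fromℕ; zero; suc)
open import Data.Bool using (Bool; true; false)
open import Data.Product using (Σ; _×_; ∃)
open import Relation.Binary.PropositionalEquality using (_≡_)
open import Relation.Nullary using (¬_; yes; no)

Matrix : ℕ → Set
Matrix n = Fin n → Fin n → ℕ

sumFin : ∀ {n} → (Fin n → ℕ) → ℕ
sumFin {zero} f = 0
sumFin {suc n} f = f zero + sumFin (λ k → f (suc k))

_⊗_ : ∀ {n} → Matrix n → Matrix n → Matrix n
(A ⊗ B) i j = sumFin (λ k → A i k * B k j)

identity : ∀ {n} → Matrix n
identity i j with toℕ i ≟ toℕ j
... | yes _ = 1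
... | no _ = 0

_^ᴹ_ : ∀ {n} → Matrix n → ℕ → Matrix n
B ^ᴹ zero = identity
B ^ᴹ suc k = B ⊗ (B ^ᴹ k)

transpose : ∀ {n} → Matrix n → Matrix n
transpose A i j = A j i

_⊕_ : ∀ {n} → Matrix n → Matrix n → Matrix n
(A ⊕ B) i j = A i j + B i j

Positive : ∀ {n} → Matrix n → Set
Positive {n} B = ∀ (i j : Fin n) → 0 < B i j

Primitive : ∀ {n} → Matrix n → Set
Primitive B = ∃ λ k → 1 ≤ k × Positive (B ^ᴹ k)

IsExponent : ∀ {n} → Matrix n → ℕ → Set
IsExponent B k = 1 ≤ k × Positive (B ^ᴹ k) × (∀ j → 1 ≤ j → j < k → ¬ Positive (B ^ᴹ j))

b2n : Bool → ℕ
b2n true = 1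
b2n false = 0

-- The matrix A ∈ C_n determined by its last row r (entries in {0,1}):
-- rows 1..n-1 (indices 0..n-2) have a single 1 in column i+1; last row is r.
companion : ∀ n → (Fin n → Bool) → Matrix n
companion n r i j with suc (toℕ i) ≟ n
... | yes _ = b2n (r j)
... | no _ with suc (toℕ i) ≟ toℕ j
...   | yes _ = 1
...   | no _ = 0

F : ∀ {n} → Matrix n → Matrix n
F A = A ⊕ transpose A

firstIx : ∀ {m} → Fin (suc m)
firstIx = zero

lastIx : ∀ {m} → Fin (suc m)
lastIx {m} = fromℕ m

-- View the nonnegative matrix M = F(A) as an undirected graph: M^k > 0 at (i, j) iff there is
-- a walk of length k from i to j. For A ∈ C_n every edge of F(A) avoiding the last vertex h
-- joins consecutive indices, so off h the graph is bipartite by index parity, and an odd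
-- closed walk must pass through h. If M^k > 0 with k odd, every vertex u therefore has walks
-- u → h and h → u of lengths a + b = k. Joining such halves for u and for v, one of the two
-- complementary pairings has even length at most k − 1, and padding it with back-and-forth
-- steps gives M^(k−1) > 0. Hence the exponent cannot be odd.
module Submission where

open import Defs
import Data.Nat as ℕ
open import Data.Nat using (ℕ; zero; suc; _+_; _*_; _≤_; _<_; _≤?_; z≤n; s≤s; z<s; s≤s⁻¹)
open import Data.Nat.Properties
  using ( +-comm; +-assoc; +-identityʳ; *-zeroʳ; *-mono-<; +-mono-<; m≤m+n; m≤n+m
        ; <-≤-trans; ≰⇒>; <-irrefl; n≮0; n<1+n; m≤n⇒m<n∨m≡n; m≤n⇒∃[o]m+o≡n
        ; suc-injective; +-commutativeSemigroup)
open import Algebra.Properties.CommutativeSemigroup +-commutativeSemigroup using (interchange)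
open import Data.Nat.Divisibility using (_∣_; ∣-refl; _∣0; ∣m∣n⇒∣m+n)
open import Data.Nat.Base using (parity)
open import Data.Parity.Base as ℙ using (Parity; 0ℙ; 1ℙ; _⁻¹)
open import Data.Parity.Properties
  using (+-homo-+; suc-homo-⁻¹; p+p≡0ℙ; p≢p⁻¹; ⁻¹-involutive; ⁻¹-selfInverse)
open import Data.Bool using (Bool)
open import Data.Fin using (Fin; toℕ; _≟_) renaming (zero to fzero; suc to fsuc)
open import Data.Fin.Properties using (toℕ-injective; toℕ-fromℕ)
open import Data.Product using (∃; _×_; _,_)
open import Data.Sum using (_⊎_; inj₁; inj₂)
open import Data.Empty using (⊥-elim)
open import Relation.Nullary using (¬_; yes; no; contradiction)
open import Relation.Binary.PropositionalEquality
  using (_≡_; _≢_; refl; sym; trans; cong; subst; module ≡-Reasoning)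

m+n>0⇒m>0⊎n>0 : ∀ m n → 0 < m + n → 0 < m ⊎ 0 < n
m+n>0⇒m>0⊎n>0 zero    n p = inj₂ p
m+n>0⇒m>0⊎n>0 (suc m) n _ = inj₁ z<s

m*n>0⇒m>0×n>0 : ∀ m n → 0 < m * n → 0 < m × 0 < n
m*n>0⇒m>0×n>0 (suc m) (suc n) _ = z<s , z<s
m*n>0⇒m>0×n>0 (suc m) zero    p = ⊥-elim (n≮0 (subst (0 <_) (*-zeroʳ m) p))

sumFin>0⇒∃ : ∀ {n} (f : Fin n → ℕ) → 0 < sumFin f → ∃ λ k → 0 < f k
sumFin>0⇒∃ {suc n} f p with m+n>0⇒m>0⊎n>0 (f fzero) (sumFin (λ k → f (fsuc k))) p
... | inj₁ q = fzero , q
... | inj₂ q with k , r ← sumFin>0⇒∃ (λ k → f (fsuc k)) q = fsuc k , r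

∃⇒sumFin>0 : ∀ {n} (f : Fin n → ℕ) k → 0 < f k → 0 < sumFin f
∃⇒sumFin>0 f fzero    p = <-≤-trans p (m≤m+n (f fzero) _)
∃⇒sumFin>0 f (fsuc k) p = <-≤-trans (∃⇒sumFin>0 (λ k → f (fsuc k)) k p) (m≤n+m _ (f fzero))

identity>0⇒≡ : ∀ {n} {i j : Fin n} → 0 < identity i j → i ≡ j
identity>0⇒≡ {i = i} {j} p with toℕ i ℕ.≟ toℕ j
... | yes e = toℕ-injective e
... | no  _ = ⊥-elim (<-irrefl refl p)

identity-diagonal>0 : ∀ {n} (i : Fin n) → 0 < identity i i
identity-diagonal>0 i with toℕ i ℕ.≟ toℕ i
... | yes _  = z<s
... | no  ne = contradiction refl ne

identity-not-positive : ∀ {n} → ¬ Positive (identity {suc (suc n)})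
identity-not-positive pos = n≮0 (pos fzero (fsuc fzero))

parity-suc : ∀ n → parity (suc n) ≡ parity n ⁻¹
parity-suc n = +-homo-+ 1 n

even⇒suc-odd : ∀ n → parity n ≡ 0ℙ → parity (suc n) ≡ 1ℙ
even⇒suc-odd n n-even = trans (parity-suc n) (cong _⁻¹ n-even)

successor-parity : ∀ {a b} → suc a ≡ b → parity b ≡ parity a ⁻¹
successor-parity {a} refl = parity-suc a

parity≡0ℙ⇒2∣ : ∀ n → parity n ≡ 0ℙ → 2 ∣ n
parity≡0ℙ⇒2∣ zero          _ = 2 ∣0
parity≡0ℙ⇒2∣ (suc (suc n)) p = ∣m∣n⇒∣m+n ∣-refl (parity≡0ℙ⇒2∣ n p)

[p⁻¹+q]⁻¹≡p+q : ∀ p q → (p ⁻¹ ℙ.+ q) ⁻¹ ≡ p ℙ.+ q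
[p⁻¹+q]⁻¹≡p+q 0ℙ q = ⁻¹-involutive q
[p⁻¹+q]⁻¹≡p+q 1ℙ q = refl

p≡p+q⇒q≡0ℙ : ∀ p q → p ≡ p ℙ.+ q → q ≡ 0ℙ
p≡p+q⇒q≡0ℙ 0ℙ q  e = sym e
p≡p+q⇒q≡0ℙ 1ℙ 0ℙ _ = refl

q+q'≡1ℙ⇒p+q≡0ℙ⊎p+q'≡0ℙ : ∀ p q q' → q ℙ.+ q' ≡ 1ℙ → p ℙ.+ q ≡ 0ℙ ⊎ p ℙ.+ q' ≡ 0ℙ
q+q'≡1ℙ⇒p+q≡0ℙ⊎p+q'≡0ℙ 0ℙ 0ℙ _  _ = inj₁ refl
q+q'≡1ℙ⇒p+q≡0ℙ⊎p+q'≡0ℙ 0ℙ 1ℙ 0ℙ _ = inj₂ refl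
q+q'≡1ℙ⇒p+q≡0ℙ⊎p+q'≡0ℙ 1ℙ 1ℙ _  _ = inj₁ refl
q+q'≡1ℙ⇒p+q≡0ℙ⊎p+q'≡0ℙ 1ℙ 0ℙ 1ℙ _ = inj₂ refl

opposite-parities : ∀ {k} y y' → parity k ≡ 0ℙ → y + y' ≡ suc k → parity y ℙ.+ parity y' ≡ 1ℙ
opposite-parities {k} y y' k-even y+y' =
  trans (sym (+-homo-+ y y')) (trans (cong parity y+y') (even⇒suc-odd k k-even))

interchange-≡ : ∀ x x' y y' {a b} → x + x' ≡ a → y + y' ≡ b → (x + y) + (x' + y') ≡ a + b
interchange-≡ x x' y y' x+x' y+y' =
  trans (interchange x y x' y') (trans (cong (_+ (y + y')) x+x') (cong (_ +_) y+y'))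

m+n≡o+o⇒m≤o⊎n≤o : ∀ {m n o} → m + n ≡ o + o → m ≤ o ⊎ n ≤ o
m+n≡o+o⇒m≤o⊎n≤o {m} {n} {o} eq with m ≤? o | n ≤? o
... | yes m≤o | _       = inj₁ m≤o
... | no  _   | yes n≤o = inj₂ n≤o
... | no  m≰o | no  n≰o = ⊥-elim (<-irrefl (sym eq) (+-mono-< (≰⇒> m≰o) (≰⇒> n≰o)))

≤suc∧same-parity⇒≤ : ∀ {s k} → s ≤ suc k → parity s ≡ parity k → s ≤ k
≤suc∧same-parity⇒≤ {k = k} s≤1+k ps with m≤n⇒m<n∨m≡n s≤1+k
... | inj₁ s<1+k = s≤s⁻¹ s<1+k
... | inj₂ refl  = contradiction (sym (trans (sym (parity-suc k)) ps)) (p≢p⁻¹ (parity k))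

short-of-even-pair : ∀ {S T k} → S + T ≡ suc k + suc k → parity k ≡ 0ℙ → parity S ≡ 0ℙ
                   → (S ≤ k × parity S ≡ parity k) ⊎ (T ≤ k × parity T ≡ parity k)
short-of-even-pair {S} {T} {k} eq k-even S-even with m+n≡o+o⇒m≤o⊎n≤o eq
... | inj₁ S≤1+k = inj₁ (≤suc∧same-parity⇒≤ S≤1+k S≡k , S≡k)
  where S≡k = trans S-even (sym k-even)
... | inj₂ T≤1+k = inj₂ (≤suc∧same-parity⇒≤ T≤1+k T≡k , T≡k)
  where
  open ≡-Reasoning
  T≡k : parity T ≡ parity k
  T≡k = begin
    parity T                              ≡⟨ cong (ℙ._+ parity T) (sym S-even) ⟩
    parity S ℙ.+ parity T                 ≡⟨ sym (+-homo-+ S T) ⟩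
    parity (S + T)                        ≡⟨ cong parity eq ⟩
    parity (suc k + suc k)                ≡⟨ +-homo-+ (suc k) (suc k) ⟩
    parity (suc k) ℙ.+ parity (suc k)     ≡⟨ p+p≡0ℙ (parity (suc k)) ⟩
    0ℙ                                    ≡⟨ sym k-even ⟩
    parity k                              ∎

IsSymmetric : ∀ {n} → Matrix n → Set
IsSymmetric M = ∀ i j → M i j ≡ M j i

infixr 5 _∷_

data Walk {n} (M : Matrix n) : ℕ → Fin n → Fin n → Set where
  []  : ∀ {i} → Walk M 0 i i
  _∷_ : ∀ {k i j l} → 0 < M i j → Walk M k j l → Walk M (suc k) i l

ShortWalk : ∀ {n} → Matrix n → ℕ → Fin n → Fin n → Set
ShortWalk M k i j = ∃ λ s → s ≤ k × parity s ≡ parity k × Walk M s i j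

record WalkVia {n} (M : Matrix n) (h : Fin n) (k : ℕ) (i j : Fin n) : Set where
  constructor via
  field
    {before after} : ℕ
    to     : Walk M before i h
    from   : Walk M after h j
    splits : before + after ≡ k

module _ {n} {M : Matrix n} where

  infixr 5 _++_

  walk⇒^ᴹ>0 : ∀ {k i j} → Walk M k i j → 0 < (M ^ᴹ k) i j
  walk⇒^ᴹ>0 {i = i} []                       = identity-diagonal>0 i
  walk⇒^ᴹ>0 (_∷_ {k} {i} {x} {j} e w) =
    ∃⇒sumFin>0 (λ y → M i y * (M ^ᴹ k) y j) x (*-mono-< e (walk⇒^ᴹ>0 w))

  ^ᴹ>0⇒walk : ∀ k {i j} → 0 < (M ^ᴹ k) i j → Walk M k i j
  ^ᴹ>0⇒walk zero    p with refl ← identity>0⇒≡ p = []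
  ^ᴹ>0⇒walk (suc k) {i} {j} p with x , q ← sumFin>0⇒∃ (λ y → M i y * (M ^ᴹ k) y j) p
    with e , r ← m*n>0⇒m>0×n>0 _ _ q = e ∷ ^ᴹ>0⇒walk k r

  _++_ : ∀ {a b i j l} → Walk M a i j → Walk M b j l → Walk M (a + b) i l
  []      ++ w = w
  (e ∷ v) ++ w = e ∷ (v ++ w)

  reverse : IsSymmetric M → ∀ {k i j} → Walk M k i j → Walk M k j i
  reverse M-sym []                      = []
  reverse M-sym (_∷_ {k} {i} {x} {j} e w) =
    subst (λ l → Walk M l j i) (+-comm k 1) (reverse M-sym w ++ subst (0 <_) (M-sym i x) e ∷ [])

  there-and-back : IsSymmetric M → ∀ {i j} → 0 < M i j → Walk M 2 i i
  there-and-back M-sym {i} {j} e = e ∷ subst (0 <_) (M-sym i j) e ∷ []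

  power-positive⇒loop : IsSymmetric M → ∀ {k} → Positive (M ^ᴹ suc k) → ∀ j → Walk M 2 j j
  power-positive⇒loop M-sym {k} pos j with e ∷ _ ← ^ᴹ>0⇒walk (suc k) (pos j j) = there-and-back M-sym e

  pad : ∀ {a i j} → Walk M 2 j j → ∀ d → parity d ≡ 0ℙ → Walk M a i j → Walk M (a + d) i j
  pad {a} {i} {j} loop zero          _ w = subst (λ l → Walk M l i j) (sym (+-identityʳ a)) w
  pad {a} {i} {j} loop (suc (suc d)) p w = subst (λ l → Walk M l i j) a+d+2≡a+[2+d] (pad loop d p w ++ loop)
    where a+d+2≡a+[2+d] = trans (+-assoc a d 2) (cong (a +_) (+-comm d 2))

  lengthen : ∀ {a b i j} → Walk M 2 j j → a ≤ b → parity a ≡ parity b → Walk M a i j → Walk M b i j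
  lengthen {a} loop a≤b pa≡pb w with d , refl ← m≤n⇒∃[o]m+o≡n a≤b =
    pad loop d (p≡p+q⇒q≡0ℙ (parity a) (parity d) (trans pa≡pb (+-homo-+ a d))) w

  shorter-of : ∀ {S T k i j} → parity k ≡ 0ℙ → S + T ≡ suc k + suc k → parity S ≡ 0ℙ
             → Walk M S i j → Walk M T i j → ShortWalk M k i j
  shorter-of k-even eq S-even v v' with short-of-even-pair eq k-even S-even
  ... | inj₁ (S≤k , pS) = _ , S≤k , pS , v
  ... | inj₂ (T≤k , pT) = _ , T≤k , pT , v'

  join-short : ∀ {h i j k x x' y y'} → parity k ≡ 0ℙ → x + x' ≡ suc k → y + y' ≡ suc k
             → Walk M x i h → Walk M x' i h → Walk M y h j → Walk M y' h j → ShortWalk M k i j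
  join-short {k = k} {x} {x'} {y} {y'} k-even x+x' y+y' p p' q q'
    with q+q'≡1ℙ⇒p+q≡0ℙ⊎p+q'≡0ℙ (parity x) (parity y) (parity y') (opposite-parities y y' k-even y+y')
  ... | inj₁ xy-even  = shorter-of k-even (interchange-≡ x x' y y' x+x' y+y')
                          (trans (+-homo-+ x y) xy-even) (p ++ q) (p' ++ q')
  ... | inj₂ xy'-even = shorter-of k-even (interchange-≡ x x' y' y x+x' (trans (+-comm y' y) y+y'))
                          (trans (+-homo-+ x y') xy'-even) (p ++ q') (p' ++ q)

record BipartiteOutside {n} (M : Matrix n) (h : Fin n) : Set where
  field
    symmetric  : IsSymmetric M
    colour     : Fin n → Parity
    alternates : ∀ {i j} → i ≢ h → j ≢ h → 0 < M i j → colour j ≡ colour i ⁻¹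

module _ {n} {M : Matrix n} {h : Fin n} (bip : BipartiteOutside M h) where
  open BipartiteOutside bip

  via-or-parity : ∀ {k i j} → Walk M k i j → WalkVia M h k i j ⊎ parity k ≡ colour i ℙ.+ colour j
  via-or-parity {i = i} [] = inj₂ (sym (p+p≡0ℙ (colour i)))
  via-or-parity {i = i} (e ∷ w) with i ≟ h
  ... | yes refl = inj₁ (via [] (e ∷ w) refl)
  via-or-parity {suc k} {i} {j} (_∷_ {j = x} e w) | no i≢h with via-or-parity w | x ≟ h
  ... | inj₁ (via p q splits) | _        = inj₁ (via (e ∷ p) q (cong suc splits))
  ... | inj₂ _                | yes refl = inj₁ (via (e ∷ []) w refl)
  ... | inj₂ k-parity         | no x≢h   = inj₂ (begin
    parity (suc k)                      ≡⟨ parity-suc k ⟩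
    parity k ⁻¹                         ≡⟨ cong _⁻¹ k-parity ⟩
    (colour x ℙ.+ colour j) ⁻¹          ≡⟨ cong (λ c → (c ℙ.+ colour j) ⁻¹) (alternates i≢h x≢h e) ⟩
    (colour i ⁻¹ ℙ.+ colour j) ⁻¹       ≡⟨ [p⁻¹+q]⁻¹≡p+q (colour i) (colour j) ⟩
    colour i ℙ.+ colour j               ∎)
    where open ≡-Reasoning

  odd-closed-walk-via : ∀ {k i} → parity k ≡ 1ℙ → Walk M k i i → WalkVia M h k i i
  odd-closed-walk-via {i = i} k-odd w with via-or-parity w
  ... | inj₁ v        = v
  ... | inj₂ k-parity = contradiction (trans (sym k-odd) (trans k-parity (p+p≡0ℙ (colour i)))) λ ()

  odd-power-positive⇒even-power-positive : ∀ {k} → parity k ≡ 0ℙ → Positive (M ^ᴹ suc k)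
                                         → Positive (M ^ᴹ k)
  odd-power-positive⇒even-power-positive {k} k-even pos i j
    with via p q splits    ← odd-closed-walk-via (even⇒suc-odd k k-even) (^ᴹ>0⇒walk (suc k) (pos i i))
       | via p' q' splits' ← odd-closed-walk-via (even⇒suc-odd k k-even) (^ᴹ>0⇒walk (suc k) (pos j j))
    with s , s≤k , s-parity , w ← join-short k-even splits splits'
                                    p (reverse symmetric q) (reverse symmetric p') q'
    = walk⇒^ᴹ>0 (lengthen (power-positive⇒loop symmetric {k} pos j) s≤k s-parity w)

below-exponent-not-positive : ∀ {n} {M : Matrix (suc (suc n))} {k} → IsExponent M k
                            → ∀ j → j < k → ¬ Positive (M ^ᴹ j)
below-exponent-not-positive _                 zero    _   = identity-not-positive
below-exponent-not-positive (_ , _ , minimal) (suc j) j<k = minimal (suc j) (s≤s z≤n) j<k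

exponent-even : ∀ {n} {M : Matrix (suc (suc n))} {h} → BipartiteOutside M h
              → ∀ {k} → IsExponent M k → parity k ≡ 0ℙ
exponent-even bip {suc k} exponent@(_ , pos , _) with parity (suc k) in k+1-parity
... | 0ℙ = refl
... | 1ℙ = ⊥-elim (below-exponent-not-positive exponent k (n<1+n k)
             (odd-power-positive⇒even-power-positive bip {k} k-even pos))
  where k-even = trans (sym (suc-homo-⁻¹ k)) (cong _⁻¹ k+1-parity)

companion>0⇒ : ∀ n r {i j} → 0 < companion n r i j → suc (toℕ i) ≡ n ⊎ suc (toℕ i) ≡ toℕ j
companion>0⇒ n r {i} {j} p with suc (toℕ i) ℕ.≟ n
... | yes e = inj₁ e
... | no _ with suc (toℕ i) ℕ.≟ toℕ j
...   | yes e = inj₂ e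
...   | no  _ = ⊥-elim (n≮0 p)

F-companion-bipartite : ∀ m r → BipartiteOutside (F (companion (suc m) r)) lastIx
F-companion-bipartite m r = record
  { symmetric  = λ i j → +-comm (companion (suc m) r i j) _
  ; colour     = λ i → parity (toℕ i)
  ; alternates = alternates
  }
  where
  last : ∀ {i : Fin (suc m)} → suc (toℕ i) ≡ suc m → i ≡ lastIx
  last e = toℕ-injective (trans (suc-injective e) (sym (toℕ-fromℕ m)))
  alternates : ∀ {i j} → i ≢ lastIx → j ≢ lastIx → 0 < F (companion (suc m) r) i j
             → parity (toℕ j) ≡ parity (toℕ i) ⁻¹
  alternates {i} {j} i≢h j≢h p
    with m+n>0⇒m>0⊎n>0 (companion (suc m) r i j) (companion (suc m) r j i) p
  ... | inj₁ ij with companion>0⇒ (suc m) r ij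
  ...   | inj₁ i-last = contradiction (last i-last) i≢h
  ...   | inj₂ i+1≡j  = successor-parity i+1≡j
  alternates {i} {j} i≢h j≢h p | inj₂ ji with companion>0⇒ (suc m) r ji
  ...   | inj₁ j-last = contradiction (last j-last) j≢h
  ...   | inj₂ j+1≡i  = sym (⁻¹-selfInverse (sym (successor-parity j+1≡i)))

corollary2 : (m : ℕ) → 3 ≤ suc m → (α e : Bool) → (r : Fin (suc m) → Bool)
    → r firstIx ≡ α → r lastIx ≡ e
    → Primitive (F (companion (suc m) r))
    → (k : ℕ) → IsExponent (F (companion (suc m) r)) k → 2 ∣ k
corollary2 zero    (s≤s ()) _ _ _ _ _ _ _ _
corollary2 (suc m) _        _ _ r _ _ _ k exponent =
  parity≡0ℙ⇒2∣ k (exponent-even (F-companion-bipartite (suc m) r) exponent)
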